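{- For $m\ge1$, the $m\times m$ matrix $M_{2m-1}=[\tilde C_{2m+1-i-j}(q)]_{i,j=1}^m$ over $\mathbb{Z}[q]$ has Smith normal form $\mathrm{diag}(q^{\binom{2m-1}{2}},q^{\binom{2m-3}{2}},q^{\binom{2m-5}{2}},\dots,q^3,1)$, and the $(m+1)\times(m+1)$ matrix $M_{2m}=[\tilde C_{2m+2-i-j}(q)]_{i,j=1}^{m+1}$ has Smith normal form $\mathrm{diag}(q^{\binom{2m}{2}},q^{\binom{2m-2}{2}},q^{\binom{2m-4}{2}},\dots,q,1)$. That is, in each case there exist matrices $P,Q$ over $\mathbb{Z}[q]$ with inverses over $\mathbb{Z}[q]$ such that $P M Q$ equals the stated diagonal matrix.
   Context: For $k\ge1$ let $\delta_k$ denote the staircase partition $(k-1,k-2,\dots,1)$ (with $\delta_1=\emptyset$), which has $\binom{k}{2}$ squares. The $q$-Catalan numbers (of Fürlinger–Hofbauer) are $\tilde C_k(q)=\sum_{\mu\subseteq\delta_k}q^{\binom{k}{2}-|\mu|}$, the sum over all partitions $\mu$ whose Young diagram is contained in that of $\delta_k$; e.g. $\tilde C_1=1$, $\tilde C_2=1+q$, $\tilde C_3=1+2q+q^2+q^3$. -}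

module Defs where

open import Data.Nat using (ℕ; zero; suc; _∸_; _≤ᵇ_) renaming (_+_ to _+ℕ_)
open import Data.Nat.Combinatorics using (_C_)
open import Data.Integer using (ℤ; 0ℤ; 1ℤ) renaming (_+_ to _+ℤ_; _*_ to _*ℤ_)
open import Data.Bool using (Bool; true; false; _∧_; if_then_else_)
open import Data.List using (List; []; _∷_; map; concatMap; filter; length; foldr; upTo)
open import Data.Fin using (Fin; toℕ)
import Data.Fin
import Data.Nat
open import Data.Product using (Σ; _×_; _,_; ∃)
open import Relation.Binary.PropositionalEquality using (_≡_)
open import Relation.Nullary.Decidable using (Dec; yes; no)
open import Data.Bool.Properties using (T?)
open import Data.Bool using (T)

-- Polynomials in ℤ[q], as coefficient lists (constant term first).

Poly : Set
Poly = List ℤ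

coeff : Poly → ℕ → ℤ
coeff []       _       = 0ℤ
coeff (a ∷ p) zero    = a
coeff (a ∷ p) (suc n) = coeff p n

-- Equality of polynomials: all coefficients agree (trailing zeros irrelevant).
_≈P_ : Poly → Poly → Set
p ≈P r = ∀ n → coeff p n ≡ coeff r n

0P : Poly
0P = []

1P : Poly
1P = 1ℤ ∷ []

_+P_ : Poly → Poly → Poly
[]      +P r       = r
(a ∷ p) +P []      = a ∷ p
(a ∷ p) +P (b ∷ r) = (a +ℤ b) ∷ (p +P r)

scale : ℤ → Poly → Poly
scale c = map (c *ℤ_)

_*P_ : Poly → Poly → Poly
[]      *P r = []
(a ∷ p) *P r = scale a r +P (0ℤ ∷ (p *P r))

qPow : ℕ → Poly
qPow zero    = 1P
qPow (suc n) = 0ℤ ∷ qPow n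

sumP : List Poly → Poly
sumP = foldr _+P_ 0P

-- Partitions contained in the staircase δ_k = (k-1, k-2, …, 1).
-- A partition μ ⊆ δ_k is recorded as its list of parts
-- (μ_1, …, μ_{k-1}) padded with zeros to length k-1.

allLists : ℕ → ℕ → List (List ℕ)
allLists zero    b = [] ∷ []
allLists (suc n) b = concatMap (λ x → map (x ∷_) (allLists n b)) (upTo b)

decreasing : List ℕ → Bool
decreasing []           = true
decreasing (x ∷ [])     = true
decreasing (x ∷ y ∷ xs) = (y ≤ᵇ x) ∧ decreasing (y ∷ xs)

-- μ_i ≤ c - i + 1 for the i-th entry (i = 1,2,…), called with c = k-1
underStair : ℕ → List ℕ → Bool
underStair c []       = true
underStair c (x ∷ xs) = (x ≤ᵇ c) ∧ underStair (c ∸ 1) xs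

inStaircase : ℕ → List ℕ → Bool
inStaircase k μ = decreasing μ ∧ underStair (k ∸ 1) μ

subStaircase : ℕ → List (List ℕ)
subStaircase k = filter (λ μ → T? (inStaircase k μ)) (allLists (k ∸ 1) k)

size : List ℕ → ℕ
size = foldr _+ℕ_ 0

qCat : ℕ → Poly
qCat k = sumP (map (λ μ → qPow ((k C 2) ∸ size μ)) (subStaircase k))

Mat : ℕ → Set
Mat n = Fin n → Fin n → Poly

sumFin : (n : ℕ) → (Fin n → Poly) → Poly
sumFin zero    f = 0P
sumFin (suc n) f = f Fin.zero +P sumFin n (λ i → f (Fin.suc i))

_*M_ : {n : ℕ} → Mat n → Mat n → Mat n
_*M_ {n} A B i j = sumFin n (λ k → A i k *P B k j)

_≈M_ : {n : ℕ} → Mat n → Mat n → Set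
A ≈M B = ∀ i j → A i j ≈P B i j

idM : {n : ℕ} → Mat n
idM i j with Data.Fin._≟_ i j
... | yes _ = 1P
... | no  _ = 0P

diagM : {n : ℕ} → (Fin n → Poly) → Mat n
diagM d i j with Data.Fin._≟_ i j
... | yes _ = d i
... | no  _ = 0P

Invertible : {n : ℕ} → Mat n → Set
Invertible {n} A = Σ (Mat n) (λ B → ((A *M B) ≈M idM) × ((B *M A) ≈M idM))

EquivTo : {n : ℕ} → Mat n → Mat n → Set
EquivTo {n} A D =
  Σ (Mat n) (λ P → Σ (Mat n) (λ Q →
    Invertible P × Invertible Q × (((P *M A) *M Q) ≈M D)))

-- The Hankel matrices (0-indexed i, j)

Modd : (m : ℕ) → Mat m
Modd m i j = qCat ((2 Data.Nat.* m +ℕ 1) ∸ (suc (toℕ i) +ℕ suc (toℕ j)))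

Meven : (m : ℕ) → Mat (suc m)
Meven m i j = qCat ((2 Data.Nat.* m +ℕ 2) ∸ (suc (toℕ i) +ℕ suc (toℕ j)))

Dodd : (m : ℕ) → Mat m
Dodd m = diagM (λ t → qPow (((2 Data.Nat.* m ∸ 1) ∸ 2 Data.Nat.* toℕ t) C 2))

Deven : (m : ℕ) → Mat (suc m)
Deven m = diagM (λ t → qPow ((2 Data.Nat.* m ∸ 2 Data.Nat.* toℕ t) C 2))

module Submission where

-- Following Viennot's lattice-path approach, C̃_k is the weight of all Dyck
-- paths of length 2k when a down step from height h+1 to h has weight q^h
-- (qCat-paths; a partition μ ⊆ δ_k is read off the path row by row, and
-- stairGF records the recursion in its first part).  Cutting a Dyck path
-- of length 2(a+b) (resp. 2(a+b+1)) at time 2a (resp. 2a+1) factors the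
-- Hankel matrices [C̃_{i+j}] and [C̃_{i+j+1}] as L D Lᵀ, where L counts paths
-- from height 0 and is unitriangular, and D = diag(q^binom(h,2)) over even
-- (resp. odd) heights h.  A unitriangular L is invertible over ℤ[q], so the
-- Hankel matrix is equivalent to D (ldl-equiv).  M_{2m-1} and M_{2m} are
-- these Hankel matrices with rows and columns in reverse order, and
-- reversal preserves equivalence.

open import Defs
open import Data.Nat as ℕ using (ℕ; zero; suc; _<_; _≤_; s≤s; z≤n; _∸_; _≤ᵇ_)
open import Data.Integer as ℤ using (0ℤ; -1ℤ)
import Data.Integer.Properties as ℤP
import Data.Nat.Properties as NP
open import Data.List using (List; []; _∷_; map; _++_; concatMap; filter; applyUpTo; upTo; length)
import Data.List.Properties as ListP
open import Data.Bool using (Bool; true; false; _∧_; if_then_else_; T)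
import Data.Bool.Properties as BoolP
open import Data.Nat.Combinatorics using (_C_; nC1≡n; nCk+nC[k+1]≡[n+1]C[k+1])
open import Data.Nat.Solver using (module +-*-Solver)
open import Function using (Equivalence)
open import Data.Sum using (_⊎_; inj₁; inj₂)
open import Data.Fin as Fin using (Fin; toℕ)
import Data.Fin.Properties as FinP
open import Data.Product using (Σ; _,_; _×_; proj₁; proj₂)
open import Data.Empty using (⊥-elim)
open import Relation.Nullary using (yes; no)
open import Relation.Binary.PropositionalEquality as Eq
  using (_≡_; refl; cong; cong₂; sym; trans)
open import Relation.Binary.Bundles using (Setoid)
open import Algebra.Bundles using (CommutativeSemigroup)
import Relation.Binary.Reasoning.Setoid as SetoidReasoning

-- Polynomials are coefficient lists, so ℤ[q] is a commutative ring only up to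
-- coefficientwise equality _≈_: the relation _≈P_ wrapped in a record,
-- so that Agda can infer the two polynomials from a proof.
infix 4 _≈_
record _≈_ (p r : Poly) : Set where
  constructor coeffwise
  field coeff≡ : ∀ n → coeff p n ≡ coeff r n
open _≈_ public

≈-refl : ∀ {p} → p ≈ p
≈-refl = coeffwise λ n → refl

≈-sym : ∀ {p r} → p ≈ r → r ≈ p
≈-sym e = coeffwise λ n → sym (coeff≡ e n)

≈-trans : ∀ {p r s} → p ≈ r → r ≈ s → p ≈ s
≈-trans e f = coeffwise λ n → trans (coeff≡ e n) (coeff≡ f n)

≡⇒≈ : ∀ {p r} → p ≡ r → p ≈ r
≡⇒≈ refl = ≈-refl

Poly-setoid : Setoid _ _
Poly-setoid = record
  { Carrier = Poly ; _≈_ = _≈_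
  ; isEquivalence = record { refl = ≈-refl ; sym = ≈-sym ; trans = ≈-trans } }

module ≈-Reasoning = SetoidReasoning Poly-setoid

∷-cong : ∀ {a b p r} → a ≡ b → p ≈ r → (a ∷ p) ≈ (b ∷ r)
∷-cong e f = coeffwise λ { zero → e ; (suc n) → coeff≡ f n }

∷-tail : ∀ {a b p r} → (a ∷ p) ≈ (b ∷ r) → p ≈ r
∷-tail e = coeffwise λ n → coeff≡ e (suc n)

0∷0P≈0P : (0ℤ ∷ 0P) ≈ 0P
0∷0P≈0P = coeffwise λ { zero → refl ; (suc n) → refl }

coeff-+ : ∀ p r n → coeff (p +P r) n ≡ coeff p n ℤ.+ coeff r n
coeff-+ []      r       n       = sym (ℤP.+-identityˡ _)
coeff-+ (a ∷ p) []      n       = sym (ℤP.+-identityʳ _)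
coeff-+ (a ∷ p) (b ∷ r) zero    = refl
coeff-+ (a ∷ p) (b ∷ r) (suc n) = coeff-+ p r n

coeff-scale : ∀ c p n → coeff (scale c p) n ≡ c ℤ.* coeff p n
coeff-scale c []      n       = sym (ℤP.*-zeroʳ c)
coeff-scale c (a ∷ p) zero    = refl
coeff-scale c (a ∷ p) (suc n) = coeff-scale c p n

+P-coeffwise : ∀ p r s t → (∀ n → coeff p n ℤ.+ coeff r n ≡ coeff s n ℤ.+ coeff t n) →
               (p +P r) ≈ (s +P t)
+P-coeffwise p r s t e =
  coeffwise λ n → trans (coeff-+ p r n) (trans (e n) (sym (coeff-+ s t n)))

+P-cong : ∀ {p p' r r'} → p ≈ p' → r ≈ r' → (p +P r) ≈ (p' +P r')
+P-cong {p} {p'} {r} {r'} e f = +P-coeffwise p r p' r' λ n → cong₂ ℤ._+_ (coeff≡ e n) (coeff≡ f n)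

+P-comm : ∀ p r → (p +P r) ≈ (r +P p)
+P-comm p r = +P-coeffwise p r r p λ n → ℤP.+-comm (coeff p n) (coeff r n)

+P-assoc : ∀ p r s → ((p +P r) +P s) ≈ (p +P (r +P s))
+P-assoc p r s = coeffwise λ n → begin
  coeff ((p +P r) +P s) n                 ≡⟨ coeff-+ (p +P r) s n ⟩
  coeff (p +P r) n ℤ.+ coeff s n          ≡⟨ cong (ℤ._+ coeff s n) (coeff-+ p r n) ⟩
  (coeff p n ℤ.+ coeff r n) ℤ.+ coeff s n ≡⟨ ℤP.+-assoc (coeff p n) _ _ ⟩
  coeff p n ℤ.+ (coeff r n ℤ.+ coeff s n) ≡⟨ cong (λ x → coeff p n ℤ.+ x) (coeff-+ r s n) ⟨
  coeff p n ℤ.+ coeff (r +P s) n          ≡⟨ coeff-+ p (r +P s) n ⟨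
  coeff (p +P (r +P s)) n                 ∎
  where open Eq.≡-Reasoning

+P-identityʳ : ∀ p → (p +P 0P) ≈ p
+P-identityʳ p = coeffwise λ n → trans (coeff-+ p 0P n) (ℤP.+-identityʳ _)

+P-zero : ∀ {p r} → p ≈ 0P → r ≈ 0P → (p +P r) ≈ 0P
+P-zero e f = +P-cong e f

-- (Poly, +P) as a commutative semigroup, to reuse the library's
-- rearrangement lemmas interchange and x∙yz≈y∙xz
+P-commutativeSemigroup : CommutativeSemigroup _ _
+P-commutativeSemigroup = record
  { Carrier = Poly ; _≈_ = _≈_ ; _∙_ = _+P_
  ; isCommutativeSemigroup = record
    { isSemigroup = record
      { isMagma = record
        { isEquivalence = Setoid.isEquivalence Poly-setoid ; ∙-cong = +P-cong }
      ; assoc = +P-assoc }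
    ; comm = +P-comm } }

open import Algebra.Properties.CommutativeSemigroup +P-commutativeSemigroup
  using (interchange; x∙yz≈y∙xz)

scale-cong : ∀ c {p r} → p ≈ r → scale c p ≈ scale c r
scale-cong c {p} {r} e = coeffwise λ n →
  trans (coeff-scale c p n) (trans (cong (c ℤ.*_) (coeff≡ e n)) (sym (coeff-scale c r n)))

scale-by-0 : ∀ {a} p → a ≡ 0ℤ → scale a p ≈ 0P
scale-by-0 {a} p refl = coeffwise λ n → coeff-scale 0ℤ p n

scale-distrib-+P : ∀ c p r → scale c (p +P r) ≈ (scale c p +P scale c r)
scale-distrib-+P c p r = coeffwise λ n → begin
  coeff (scale c (p +P r)) n                  ≡⟨ coeff-scale c (p +P r) n ⟩
  c ℤ.* coeff (p +P r) n                      ≡⟨ cong (c ℤ.*_) (coeff-+ p r n) ⟩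
  c ℤ.* (coeff p n ℤ.+ coeff r n)             ≡⟨ ℤP.*-distribˡ-+ c (coeff p n) _ ⟩
  c ℤ.* coeff p n ℤ.+ c ℤ.* coeff r n         ≡⟨ cong₂ ℤ._+_ (coeff-scale c p n) (coeff-scale c r n) ⟨
  coeff (scale c p) n ℤ.+ coeff (scale c r) n ≡⟨ coeff-+ (scale c p) _ n ⟨
  coeff (scale c p +P scale c r) n            ∎
  where open Eq.≡-Reasoning

scale-distrib-+ : ∀ a b p → scale (a ℤ.+ b) p ≈ (scale a p +P scale b p)
scale-distrib-+ a b p = coeffwise λ n → begin
  coeff (scale (a ℤ.+ b) p) n                 ≡⟨ coeff-scale (a ℤ.+ b) p n ⟩
  (a ℤ.+ b) ℤ.* coeff p n                     ≡⟨ ℤP.*-distribʳ-+ (coeff p n) a b ⟩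
  a ℤ.* coeff p n ℤ.+ b ℤ.* coeff p n         ≡⟨ cong₂ ℤ._+_ (coeff-scale a p n) (coeff-scale b p n) ⟨
  coeff (scale a p) n ℤ.+ coeff (scale b p) n ≡⟨ coeff-+ (scale a p) _ n ⟨
  coeff (scale a p +P scale b p) n            ∎
  where open Eq.≡-Reasoning

scale-scale : ∀ a b p → scale a (scale b p) ≈ scale (a ℤ.* b) p
scale-scale a b p = coeffwise λ n → begin
  coeff (scale a (scale b p)) n ≡⟨ coeff-scale a (scale b p) n ⟩
  a ℤ.* coeff (scale b p) n     ≡⟨ cong (a ℤ.*_) (coeff-scale b p n) ⟩
  a ℤ.* (b ℤ.* coeff p n)       ≡⟨ ℤP.*-assoc a b _ ⟨
  (a ℤ.* b) ℤ.* coeff p n       ≡⟨ coeff-scale (a ℤ.* b) p n ⟨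
  coeff (scale (a ℤ.* b) p) n   ∎
  where open Eq.≡-Reasoning

*P-annihilˡ : ∀ {z} r → z ≈ 0P → (z *P r) ≈ 0P
*P-annihilˡ {[]}    r e = ≈-refl
*P-annihilˡ {a ∷ z} r e =
  +P-zero (scale-by-0 r (coeff≡ e 0))
          (≈-trans (∷-cong refl (*P-annihilˡ {z} r (coeffwise λ n → coeff≡ e (suc n)))) 0∷0P≈0P)

*P-congˡ : ∀ {p p'} r → p ≈ p' → (p *P r) ≈ (p' *P r)
*P-congˡ {[]}    {p'}     r e = ≈-sym (*P-annihilˡ r (≈-sym e))
*P-congˡ {a ∷ p} {[]}     r e = *P-annihilˡ r e
*P-congˡ {a ∷ p} {b ∷ p'} r e =
  +P-cong (≡⇒≈ (cong (λ c → scale c r) (coeff≡ e 0))) (∷-cong refl (*P-congˡ r (∷-tail e)))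

*P-zeroʳ : ∀ p → (p *P 0P) ≈ 0P
*P-zeroʳ []      = ≈-refl
*P-zeroʳ (a ∷ p) = ≈-trans (∷-cong refl (*P-zeroʳ p)) 0∷0P≈0P

*P-∷ʳ : ∀ p b r → (p *P (b ∷ r)) ≈ (scale b p +P (0ℤ ∷ (p *P r)))
*P-∷ʳ []      b r = ≈-sym 0∷0P≈0P
*P-∷ʳ (a ∷ p) b r = ∷-cong (cong (ℤ._+ 0ℤ) (ℤP.*-comm a b))
  (≈-trans (+P-cong (≈-refl {scale a r}) (*P-∷ʳ p b r))
           (x∙yz≈y∙xz (scale a r) (scale b p) (0ℤ ∷ (p *P r))))

*P-comm : ∀ p r → (p *P r) ≈ (r *P p)
*P-comm []      r = ≈-sym (*P-zeroʳ r)
*P-comm (a ∷ p) r =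
  ≈-trans (+P-cong (≈-refl {scale a r}) (∷-cong refl (*P-comm p r))) (≈-sym (*P-∷ʳ r a p))

*P-congʳ : ∀ p {r r'} → r ≈ r' → (p *P r) ≈ (p *P r')
*P-congʳ p {r} {r'} e = ≈-trans (*P-comm p r) (≈-trans (*P-congˡ p e) (*P-comm r' p))

*P-cong : ∀ {p p' r r'} → p ≈ p' → r ≈ r' → (p *P r) ≈ (p' *P r')
*P-cong {p} {p'} {r} e f = ≈-trans (*P-congˡ r e) (*P-congʳ p' f)

*P-annihilʳ : ∀ {z} p → z ≈ 0P → (p *P z) ≈ 0P
*P-annihilʳ p e = ≈-trans (*P-congʳ p e) (*P-zeroʳ p)

*P-distribʳ : ∀ x y s → ((x +P y) *P s) ≈ ((x *P s) +P (y *P s))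
*P-distribʳ []      y       s = ≈-refl
*P-distribʳ (a ∷ x) []      s = ≈-sym (+P-identityʳ ((a ∷ x) *P s))
*P-distribʳ (a ∷ x) (b ∷ y) s = begin
  scale (a ℤ.+ b) s +P (0ℤ ∷ ((x +P y) *P s))
    ≈⟨ +P-cong (scale-distrib-+ a b s) (∷-cong refl (*P-distribʳ x y s)) ⟩
  (scale a s +P scale b s) +P ((0ℤ ∷ (x *P s)) +P (0ℤ ∷ (y *P s)))
    ≈⟨ interchange (scale a s) (scale b s) _ _ ⟩
  (scale a s +P (0ℤ ∷ (x *P s))) +P (scale b s +P (0ℤ ∷ (y *P s))) ∎
  where open ≈-Reasoning

*P-distribˡ : ∀ s x y → (s *P (x +P y)) ≈ ((s *P x) +P (s *P y))
*P-distribˡ s x y = ≈-trans (*P-comm s (x +P y))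
  (≈-trans (*P-distribʳ x y s) (+P-cong (*P-comm x s) (*P-comm y s)))

shift-*P : ∀ x s → ((0ℤ ∷ x) *P s) ≈ (0ℤ ∷ (x *P s))
shift-*P x s = +P-cong (scale-by-0 s refl) (≈-refl {0ℤ ∷ (x *P s)})

scale-*P : ∀ a r s → (scale a r *P s) ≈ scale a (r *P s)
scale-*P a []      s = ≈-refl
scale-*P a (b ∷ r) s = begin
  scale (a ℤ.* b) s +P (0ℤ ∷ (scale a r *P s))
    ≈⟨ +P-cong (≈-sym (scale-scale a b s)) (∷-cong (sym (ℤP.*-zeroʳ a)) (scale-*P a r s)) ⟩
  scale a (scale b s) +P scale a (0ℤ ∷ (r *P s))
    ≈⟨ ≈-sym (scale-distrib-+P a (scale b s) _) ⟩
  scale a (scale b s +P (0ℤ ∷ (r *P s))) ∎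
  where open ≈-Reasoning

*P-assoc : ∀ p r s → ((p *P r) *P s) ≈ (p *P (r *P s))
*P-assoc []      r s = ≈-refl
*P-assoc (a ∷ p) r s = begin
  (scale a r +P (0ℤ ∷ (p *P r))) *P s
    ≈⟨ *P-distribʳ (scale a r) _ s ⟩
  (scale a r *P s) +P ((0ℤ ∷ (p *P r)) *P s)
    ≈⟨ +P-cong (scale-*P a r s) (≈-trans (shift-*P (p *P r) s) (∷-cong refl (*P-assoc p r s))) ⟩
  scale a (r *P s) +P (0ℤ ∷ (p *P (r *P s))) ∎
  where open ≈-Reasoning

*P-identityʳ : ∀ p → (p *P 1P) ≈ p
*P-identityʳ []      = ≈-refl
*P-identityʳ (a ∷ p) = ∷-cong (trans (ℤP.+-identityʳ _) (ℤP.*-identityʳ a)) (*P-identityʳ p)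

*P-identityˡ : ∀ p → (1P *P p) ≈ p
*P-identityˡ p = ≈-trans (*P-comm 1P p) (*P-identityʳ p)

qPow-+ : ∀ a b → qPow (a ℕ.+ b) ≈ (qPow a *P qPow b)
qPow-+ zero    b = ≈-sym (*P-identityˡ (qPow b))
qPow-+ (suc a) b = ≈-trans (∷-cong refl (qPow-+ a b)) (≈-sym (shift-*P (qPow a) (qPow b)))

-P_ : Poly → Poly
-P_ = scale -1ℤ

+P-inverseʳ : ∀ p → (p +P (-P p)) ≈ 0P
+P-inverseʳ p = coeffwise λ n → begin
  coeff (p +P (-P p)) n              ≡⟨ coeff-+ p (-P p) n ⟩
  coeff p n ℤ.+ coeff (-P p) n       ≡⟨ cong (λ x → coeff p n ℤ.+ x) (coeff-scale -1ℤ p n) ⟩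
  coeff p n ℤ.+ -1ℤ ℤ.* coeff p n    ≡⟨ cong (λ x → coeff p n ℤ.+ x) (ℤP.-1*i≡-i (coeff p n)) ⟩
  coeff p n ℤ.+ ℤ.- coeff p n        ≡⟨ ℤP.+-inverseʳ (coeff p n) ⟩
  0ℤ                                 ∎
  where open Eq.≡-Reasoning

+P-inverseˡ : ∀ p → ((-P p) +P p) ≈ 0P
+P-inverseˡ p = ≈-trans (+P-comm (-P p) p) (+P-inverseʳ p)

*P-negʳ : ∀ p r → (p *P (-P r)) ≈ (-P (p *P r))
*P-negʳ p r = ≈-trans (*P-comm p (-P r)) (≈-trans (scale-*P -1ℤ r p) (scale-cong -1ℤ (*P-comm r p)))

sumFin-cong : ∀ n {f g : Fin n → Poly} → (∀ k → f k ≈ g k) → sumFin n f ≈ sumFin n g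
sumFin-cong zero    e = ≈-refl
sumFin-cong (suc n) e = +P-cong (e Fin.zero) (sumFin-cong n (λ k → e (Fin.suc k)))

sumFin-zero : ∀ n (f : Fin n → Poly) → (∀ k → f k ≈ 0P) → sumFin n f ≈ 0P
sumFin-zero zero    f e = ≈-refl
sumFin-zero (suc n) f e = +P-zero (e Fin.zero) (sumFin-zero n _ (λ k → e (Fin.suc k)))

sumFin-+ : ∀ n (f g : Fin n → Poly) → sumFin n (λ k → f k +P g k) ≈ (sumFin n f +P sumFin n g)
sumFin-+ zero    f g = ≈-refl
sumFin-+ (suc n) f g = ≈-trans (+P-cong (≈-refl {f Fin.zero +P g Fin.zero}) (sumFin-+ n _ _))
                               (interchange (f Fin.zero) (g Fin.zero) _ _)

sumFin-*ˡ : ∀ n p (f : Fin n → Poly) → (p *P sumFin n f) ≈ sumFin n (λ k → p *P f k)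
sumFin-*ˡ zero    p f = *P-zeroʳ p
sumFin-*ˡ (suc n) p f =
  ≈-trans (*P-distribˡ p (f Fin.zero) _) (+P-cong (≈-refl {p *P f Fin.zero}) (sumFin-*ˡ n p _))

sumFin-*ʳ : ∀ n p (f : Fin n → Poly) → (sumFin n f *P p) ≈ sumFin n (λ k → f k *P p)
sumFin-*ʳ n p f = ≈-trans (*P-comm (sumFin n f) p)
  (≈-trans (sumFin-*ˡ n p f) (sumFin-cong n (λ k → *P-comm p (f k))))

sumFin-neg : ∀ n (f : Fin n → Poly) → sumFin n (λ k → -P f k) ≈ (-P sumFin n f)
sumFin-neg zero    f = ≈-refl
sumFin-neg (suc n) f = ≈-trans (+P-cong (≈-refl {(-P f Fin.zero)}) (sumFin-neg n _))
                               (≈-sym (scale-distrib-+P -1ℤ (f Fin.zero) _))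

sumFin-swap : ∀ n m (f : Fin n → Fin m → Poly) →
  sumFin n (λ k → sumFin m (f k)) ≈ sumFin m (λ l → sumFin n (λ k → f k l))
sumFin-swap zero    m f = ≈-sym (sumFin-zero m _ (λ l → ≈-refl))
sumFin-swap (suc n) m f =
  ≈-trans (+P-cong (≈-refl {sumFin m (f Fin.zero)}) (sumFin-swap n m (λ k → f (Fin.suc k))))
          (≈-sym (sumFin-+ m _ _))

sumFin-last : ∀ n (f : Fin (suc n) → Poly) →
  sumFin (suc n) f ≈ (sumFin n (λ k → f (Fin.inject₁ k)) +P f (Fin.fromℕ n))
sumFin-last zero    f = +P-identityʳ (f Fin.zero)
sumFin-last (suc n) f = ≈-trans (+P-cong (≈-refl {f Fin.zero}) (sumFin-last n (λ k → f (Fin.suc k))))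
                                (≈-sym (+P-assoc (f Fin.zero) _ _))

sumFin-reverse : ∀ n (f : Fin n → Poly) → sumFin n (λ k → f (Fin.opposite k)) ≈ sumFin n f
sumFin-reverse zero    f = ≈-refl
sumFin-reverse (suc n) f =
  ≈-trans (+P-cong (≈-refl {f (Fin.fromℕ n)}) (sumFin-reverse n (λ k → f (Fin.inject₁ k))))
  (≈-trans (+P-comm (f (Fin.fromℕ n)) _) (≈-sym (sumFin-last n f)))

-- Σ_{k<n} f k; note sumBelow (suc n) f reduces to f 0 +P sumBelow n (f ∘ suc)
sumBelow : ℕ → (ℕ → Poly) → Poly
sumBelow n f = sumFin n (λ k → f (toℕ k))

sumBelow-cong : ∀ n {f g} → (∀ k → k < n → f k ≈ g k) → sumBelow n f ≈ sumBelow n g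
sumBelow-cong n e = sumFin-cong n (λ k → e (toℕ k) (FinP.toℕ<n k))

sumBelow-zero : ∀ n {f} → (∀ k → k < n → f k ≈ 0P) → sumBelow n f ≈ 0P
sumBelow-zero n e = sumFin-zero n _ (λ k → e (toℕ k) (FinP.toℕ<n k))

sumBelow-last : ∀ n f → sumBelow (suc n) f ≈ (sumBelow n f +P f n)
sumBelow-last zero    f = +P-identityʳ (f 0)
sumBelow-last (suc n) f = ≈-trans (+P-cong (≈-refl {f 0}) (sumBelow-last n (λ k → f (suc k))))
                                  (≈-sym (+P-assoc (f 0) _ _))

sumBelow-extend : ∀ n d f → (∀ k → n ≤ k → k < n ℕ.+ d → f k ≈ 0P) →
  sumBelow (n ℕ.+ d) f ≈ sumBelow n f
sumBelow-extend zero    d f e = sumBelow-zero d (λ k k<d → e k z≤n k<d)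
sumBelow-extend (suc n) d f e = +P-cong (≈-refl {f 0})
  (sumBelow-extend n d (λ k → f (suc k)) (λ k n≤k k<n+d → e (suc k) (s≤s n≤k) (s≤s k<n+d)))

-- Doubling by structural recursion, so that double (suc n) = suc (suc (double n));
-- Dyck paths of semilength k have length double k.
double : ℕ → ℕ
double zero    = zero
double (suc n) = suc (suc (double n))

n+n≡double : ∀ n → n ℕ.+ n ≡ double n
n+n≡double zero    = refl
n+n≡double (suc n) = cong suc (trans (NP.+-suc n n) (cong suc (n+n≡double n)))

double≡2* : ∀ n → double n ≡ 2 ℕ.* n
double≡2* n = trans (sym (n+n≡double n)) (cong (n ℕ.+_) (sym (NP.+-identityʳ n)))

double-mono-≤ : ∀ {a n} → a ≤ n → double a ≤ double n
double-mono-≤ z≤n       = z≤n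
double-mono-≤ (s≤s a≤n) = s≤s (s≤s (double-mono-≤ a≤n))

double-mono-< : ∀ {a n} → a < n → double a < double n
double-mono-< {a} a<n = NP.≤-trans (NP.n≤1+n (suc (double a))) (double-mono-≤ a<n)

double-+ : ∀ a b → double (a ℕ.+ b) ≡ double a ℕ.+ double b
double-+ zero    b = refl
double-+ (suc a) b = cong (λ t → suc (suc t)) (double-+ a b)

double-∸ : ∀ m a → double (m ∸ a) ≡ double m ∸ double a
double-∸ m a = begin
  double (m ∸ a)          ≡⟨ double≡2* (m ∸ a) ⟩
  2 ℕ.* (m ∸ a)           ≡⟨ NP.*-distribˡ-∸ 2 m a ⟩
  2 ℕ.* m ∸ 2 ℕ.* a       ≡⟨ cong₂ _∸_ (double≡2* m) (double≡2* a) ⟨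
  double m ∸ double a     ∎
  where open Eq.≡-Reasoning

sumBelow-pairs : ∀ n f →
  sumBelow (double n) f ≈ sumBelow n (λ k → f (double k) +P f (suc (double k)))
sumBelow-pairs zero    f = ≈-refl
sumBelow-pairs (suc n) f = ≈-trans (≈-sym (+P-assoc (f 0) (f 1) _))
  (+P-cong (≈-refl {f 0 +P f 1}) (sumBelow-pairs n (λ k → f (suc (suc k)))))

infix 4 _≈m_
_≈m_ : ∀ {n} → Mat n → Mat n → Set
A ≈m B = ∀ i j → A i j ≈ B i j

≈m⇒≈M : ∀ {n} {A B : Mat n} → A ≈m B → A ≈M B
≈m⇒≈M e i j = coeff≡ (e i j)

≈M⇒≈m : ∀ {n} {A B : Mat n} → A ≈M B → A ≈m B
≈M⇒≈m e i j = coeffwise (e i j)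

Mat-setoid : ℕ → Setoid _ _
Mat-setoid n = record
  { Carrier = Mat n ; _≈_ = _≈m_
  ; isEquivalence = record
    { refl  = λ i j → ≈-refl
    ; sym   = λ e i j → ≈-sym (e i j)
    ; trans = λ e f i j → ≈-trans (e i j) (f i j) } }

module ≈m-Reasoning {n} = SetoidReasoning (Mat-setoid n)

≈m-refl : ∀ {n} {A : Mat n} → A ≈m A
≈m-refl i j = ≈-refl

*M-cong : ∀ {n} {A A' B B' : Mat n} → A ≈m A' → B ≈m B' → (A *M B) ≈m (A' *M B')
*M-cong {n} e f i j = sumFin-cong n (λ k → *P-cong (e i k) (f k j))

*M-assoc : ∀ {n} (A B C : Mat n) → ((A *M B) *M C) ≈m (A *M (B *M C))
*M-assoc {n} A B C i j = begin
  sumFin n (λ k → sumFin n (λ l → A i l *P B l k) *P C k j)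
    ≈⟨ sumFin-cong n (λ k → sumFin-*ʳ n (C k j) (λ l → A i l *P B l k)) ⟩
  sumFin n (λ k → sumFin n (λ l → (A i l *P B l k) *P C k j))
    ≈⟨ sumFin-swap n n (λ k l → (A i l *P B l k) *P C k j) ⟩
  sumFin n (λ l → sumFin n (λ k → (A i l *P B l k) *P C k j))
    ≈⟨ sumFin-cong n (λ l → sumFin-cong n (λ k → *P-assoc (A i l) (B l k) (C k j))) ⟩
  sumFin n (λ l → sumFin n (λ k → A i l *P (B l k *P C k j)))
    ≈⟨ sumFin-cong n (λ l → ≈-sym (sumFin-*ˡ n (A i l) (λ k → B l k *P C k j))) ⟩
  sumFin n (λ l → A i l *P sumFin n (λ k → B l k *P C k j)) ∎
  where open ≈-Reasoning

diagM-suc : ∀ {n} (d : Fin (suc n) → Poly) (i k : Fin n) →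
  diagM d (Fin.suc i) (Fin.suc k) ≡ diagM (λ t → d (Fin.suc t)) i k
diagM-suc d i k with i Fin.≟ k
... | yes _ = refl
... | no  _ = refl

diagM-cong : ∀ {n} {d d' : Fin n → Poly} → (∀ t → d t ≈ d' t) → diagM d ≈m diagM d'
diagM-cong {d = d} {d'} e i j with i Fin.≟ j
... | yes _ = e i
... | no  _ = ≈-refl

diag-row : ∀ n (d f : Fin n → Poly) (i : Fin n) → sumFin n (λ k → diagM d i k *P f k) ≈ (d i *P f i)
diag-row (suc n) d f Fin.zero = ≈-trans
  (+P-cong (≈-refl {d Fin.zero *P f Fin.zero}) (sumFin-zero n _ (λ k → ≈-refl)))
  (+P-identityʳ _)
diag-row (suc n) d f (Fin.suc i) = begin
  sumFin n (λ k → diagM d (Fin.suc i) (Fin.suc k) *P f (Fin.suc k))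
    ≈⟨ sumFin-cong n (λ k → ≡⇒≈ (cong (_*P f (Fin.suc k)) (diagM-suc d i k))) ⟩
  sumFin n (λ k → diagM (λ t → d (Fin.suc t)) i k *P f (Fin.suc k))
    ≈⟨ diag-row n (λ t → d (Fin.suc t)) (λ k → f (Fin.suc k)) i ⟩
  d (Fin.suc i) *P f (Fin.suc i) ∎
  where open ≈-Reasoning

diag-col : ∀ n (d f : Fin n → Poly) (j : Fin n) → sumFin n (λ k → f k *P diagM d k j) ≈ (f j *P d j)
diag-col (suc n) d f Fin.zero = ≈-trans
  (+P-cong (≈-refl {f Fin.zero *P d Fin.zero}) (sumFin-zero n _ (λ k → *P-zeroʳ (f (Fin.suc k)))))
  (+P-identityʳ _)
diag-col (suc n) d f (Fin.suc j) = +P-cong (*P-zeroʳ (f Fin.zero)) (begin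
  sumFin n (λ k → f (Fin.suc k) *P diagM d (Fin.suc k) (Fin.suc j))
    ≈⟨ sumFin-cong n (λ k → ≡⇒≈ (cong (f (Fin.suc k) *P_) (diagM-suc d k j))) ⟩
  sumFin n (λ k → f (Fin.suc k) *P diagM (λ t → d (Fin.suc t)) k j)
    ≈⟨ diag-col n (λ t → d (Fin.suc t)) (λ k → f (Fin.suc k)) j ⟩
  f (Fin.suc j) *P d (Fin.suc j) ∎)
  where open ≈-Reasoning

idM≡diagM : ∀ {n} (i j : Fin n) → idM i j ≡ diagM (λ _ → 1P) i j
idM≡diagM i j with i Fin.≟ j
... | yes _ = refl
... | no  _ = refl

*M-identityˡ : ∀ {n} (A : Mat n) → (idM *M A) ≈m A
*M-identityˡ {n} A i j = ≈-trans
  (sumFin-cong n (λ k → ≡⇒≈ (cong (_*P A k j) (idM≡diagM i k))))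
  (≈-trans (diag-row n (λ _ → 1P) (λ k → A k j) i) (*P-identityˡ (A i j)))

*M-identityʳ : ∀ {n} (A : Mat n) → (A *M idM) ≈m A
*M-identityʳ {n} A i j = ≈-trans
  (sumFin-cong n (λ k → ≡⇒≈ (cong (A i k *P_) (idM≡diagM k j))))
  (≈-trans (diag-col n (λ _ → 1P) (A i) j) (*P-identityʳ (A i j)))

transpose : ∀ {n} → Mat n → Mat n
transpose A i j = A j i

transpose-*M : ∀ {n} (A B : Mat n) → transpose (A *M B) ≈m (transpose B *M transpose A)
transpose-*M {n} A B i j = sumFin-cong n (λ k → *P-comm (A j k) (B k i))

idM-sym : ∀ {n} (i j : Fin n) → idM i j ≡ idM j i
idM-sym i j with i Fin.≟ j | j Fin.≟ i
... | yes _   | yes _   = refl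
... | no  _   | no  _   = refl
... | yes i≡j | no  j≢i = ⊥-elim (j≢i (sym i≡j))
... | no  i≢j | yes j≡i = ⊥-elim (i≢j (sym j≡i))

IsInverse : ∀ {n} → Mat n → Mat n → Set
IsInverse A B = ((A *M B) ≈m idM) × ((B *M A) ≈m idM)

transpose-inverse : ∀ {n} (A B : Mat n) → IsInverse A B → IsInverse (transpose A) (transpose B)
transpose-inverse A B (AB , BA) =
  (λ i j → ≈-trans (≈-sym (transpose-*M B A i j)) (≈-trans (BA j i) (≡⇒≈ (idM-sym j i)))) ,
  (λ i j → ≈-trans (≈-sym (transpose-*M A B i j)) (≈-trans (AB j i) (≡⇒≈ (idM-sym j i))))

equivTo : ∀ {n} {A D : Mat n} (P P' Q Q' : Mat n) →
  IsInverse P P' → IsInverse Q Q' → ((P *M A) *M Q) ≈m D → EquivTo A D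
equivTo P P' Q Q' (PP' , P'P) (QQ' , Q'Q) PAQ≈D =
  P , Q , (P' , ≈m⇒≈M PP' , ≈m⇒≈M P'P) , (Q' , ≈m⇒≈M QQ' , ≈m⇒≈M Q'Q) , ≈m⇒≈M PAQ≈D

Unitriangular : ∀ {n} → Mat n → Set
Unitriangular {n} L = (∀ i → L i i ≈ 1P) × (∀ (i j : Fin n) → toℕ i < toℕ j → L i j ≈ 0P)

-- Block inversion.  Write L = [1 0; v L'], where L' = minor L drops the first
-- row and column.  If B' inverts L' then blockInverse L B' = [1 0; -B'v B']
-- inverts L.

minor : ∀ {n} → Mat (suc n) → Mat n
minor L i j = L (Fin.suc i) (Fin.suc j)

blockInverse : ∀ {n} → Mat (suc n) → Mat n → Mat (suc n)
blockInverse     L B' Fin.zero    Fin.zero    = 1P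
blockInverse     L B' Fin.zero    (Fin.suc j) = 0P
blockInverse {n} L B' (Fin.suc i) Fin.zero    = -P sumFin n (λ l → B' i l *P L (Fin.suc l) Fin.zero)
blockInverse     L B' (Fin.suc i) (Fin.suc j) = B' i j

idM-suc : ∀ {n} (i j : Fin n) → idM i j ≈ idM {suc n} (Fin.suc i) (Fin.suc j)
idM-suc i j with i Fin.≟ j
... | yes _ = ≈-refl
... | no  _ = ≈-refl

blockInverse-right : ∀ {n} (L : Mat (suc n)) (B' : Mat n) →
  L Fin.zero Fin.zero ≈ 1P → (∀ k → L Fin.zero (Fin.suc k) ≈ 0P) →
  (minor L *M B') ≈m idM → (L *M blockInverse L B') ≈m idM
blockInverse-right {n} L B' corner row₀ L'B'≈1 = LB≈1
  where
  v : Fin n → Poly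
  v i = L (Fin.suc i) Fin.zero
  B'v : Fin n → Poly
  B'v i = sumFin n (λ l → B' i l *P v l)
  -- L'(B'v) = (L'B')v = v
  L'B'v : ∀ i → sumFin n (λ k → minor L i k *P B'v k) ≈ v i
  L'B'v i = ≈-trans (≈-sym (*M-assoc (minor L) B' (λ k _ → v k) i i))
    (≈-trans (*M-cong L'B'≈1 (≈m-refl {A = λ k _ → v k}) i i) (*M-identityˡ (λ k _ → v k) i i))
  LB≈1 : (L *M blockInverse L B') ≈m idM
  LB≈1 Fin.zero Fin.zero = ≈-trans
    (+P-cong (≈-trans (*P-identityʳ _) corner) (sumFin-zero n _ (λ k → *P-annihilˡ _ (row₀ k))))
    (+P-identityʳ 1P)
  LB≈1 Fin.zero (Fin.suc j) =
    +P-zero (*P-zeroʳ (L Fin.zero Fin.zero)) (sumFin-zero n _ (λ k → *P-annihilˡ _ (row₀ k)))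
  LB≈1 (Fin.suc i) Fin.zero = ≈-trans (+P-cong (*P-identityʳ (v i)) (begin
    sumFin n (λ k → minor L i k *P (-P B'v k))   ≈⟨ sumFin-cong n (λ k → *P-negʳ (minor L i k) (B'v k)) ⟩
    sumFin n (λ k → -P (minor L i k *P B'v k))   ≈⟨ sumFin-neg n _ ⟩
    -P sumFin n (λ k → minor L i k *P B'v k)     ≈⟨ scale-cong -1ℤ (L'B'v i) ⟩
    -P v i                                       ∎)) (+P-inverseʳ (v i))
    where open ≈-Reasoning
  LB≈1 (Fin.suc i) (Fin.suc j) =
    ≈-trans (+P-cong (*P-zeroʳ (v i)) (L'B'≈1 i j)) (idM-suc i j)

blockInverse-left : ∀ {n} (L : Mat (suc n)) (B' : Mat n) →
  L Fin.zero Fin.zero ≈ 1P → (∀ k → L Fin.zero (Fin.suc k) ≈ 0P) →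
  (B' *M minor L) ≈m idM → (blockInverse L B' *M L) ≈m idM
blockInverse-left {n} L B' corner row₀ B'L'≈1 = BL≈1
  where
  B'v : Fin n → Poly
  B'v i = sumFin n (λ l → B' i l *P L (Fin.suc l) Fin.zero)
  BL≈1 : (blockInverse L B' *M L) ≈m idM
  BL≈1 Fin.zero Fin.zero = ≈-trans
    (+P-cong (≈-trans (*P-identityˡ _) corner) (sumFin-zero n _ (λ k → ≈-refl)))
    (+P-identityʳ 1P)
  BL≈1 Fin.zero (Fin.suc j) =
    +P-zero (≈-trans (*P-identityˡ _) (row₀ j)) (sumFin-zero n _ (λ k → ≈-refl))
  BL≈1 (Fin.suc i) Fin.zero = ≈-trans
    (+P-cong (≈-trans (*P-congʳ (-P B'v i) corner) (*P-identityʳ _)) (≈-refl {B'v i}))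
    (+P-inverseˡ (B'v i))
  BL≈1 (Fin.suc i) (Fin.suc j) =
    ≈-trans (+P-cong (*P-annihilʳ (-P B'v i) (row₀ j)) (B'L'≈1 i j)) (idM-suc i j)

unitriangular-inverse : ∀ n (L : Mat n) → Unitriangular L → Σ (Mat n) (IsInverse L)
unitriangular-inverse zero    L _ = (λ ()) , (λ ()) , (λ ())
unitriangular-inverse (suc n) L (diag₁ , upper₀) =
  blockInverse L B' ,
  blockInverse-right L B' (diag₁ Fin.zero) row₀ (proj₁ (proj₂ minor-inverse)) ,
  blockInverse-left  L B' (diag₁ Fin.zero) row₀ (proj₂ (proj₂ minor-inverse))
  where
  row₀ : ∀ k → L Fin.zero (Fin.suc k) ≈ 0P
  row₀ k = upper₀ Fin.zero (Fin.suc k) (s≤s z≤n)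
  minor-inverse : Σ (Mat n) (IsInverse (minor L))
  minor-inverse = unitriangular-inverse n (minor L)
    ((λ i → diag₁ (Fin.suc i)) , (λ i j i<j → upper₀ (Fin.suc i) (Fin.suc j) (s≤s i<j)))
  B' : Mat n
  B' = proj₁ minor-inverse

-- Congruence to a diagonal matrix: if H = L D Lᵀ entrywise with L
-- unitriangular, then L⁻¹ H (L⁻¹)ᵀ = D, so H is equivalent to D.
ldl-equiv : ∀ n (H L : Mat n) (d : Fin n → Poly) → Unitriangular L →
  (∀ i j → H i j ≈ sumFin n (λ k → L i k *P (d k *P L j k))) → EquivTo H (diagM d)
ldl-equiv n H L d unitri H≈LDLᵀ =
  equivTo B L (transpose B) (transpose L) B-inverse Bᵀ-inverse BHBᵀ≈D
  where
  L-inverse : Σ (Mat n) (IsInverse L)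
  L-inverse = unitriangular-inverse n L unitri
  B : Mat n
  B = proj₁ L-inverse
  B-inverse : IsInverse B L
  B-inverse = proj₂ (proj₂ L-inverse) , proj₁ (proj₂ L-inverse)
  Bᵀ-inverse : IsInverse (transpose B) (transpose L)
  Bᵀ-inverse = transpose-inverse B L B-inverse
  D : Mat n
  D = diagM d
  H≈ : H ≈m ((L *M D) *M transpose L)
  H≈ i j = ≈-trans (H≈LDLᵀ i j)
    (sumFin-cong n (λ k → ≈-trans (≈-sym (*P-assoc (L i k) (d k) (L j k)))
                                  (*P-congˡ (L j k) (≈-sym (diag-col n d (L i) k)))))
  BHBᵀ≈D : ((B *M H) *M transpose B) ≈m D
  BHBᵀ≈D = begin
    (B *M H) *M transpose B
      ≈⟨ *M-cong (*M-cong (≈m-refl {A = B}) H≈) ≈m-refl ⟩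
    (B *M ((L *M D) *M transpose L)) *M transpose B
      ≈⟨ *M-assoc B _ (transpose B) ⟩
    B *M (((L *M D) *M transpose L) *M transpose B)
      ≈⟨ *M-cong (≈m-refl {A = B}) (*M-assoc (L *M D) (transpose L) (transpose B)) ⟩
    B *M ((L *M D) *M (transpose L *M transpose B))
      ≈⟨ *M-cong (≈m-refl {A = B}) (*M-cong (≈m-refl {A = L *M D}) (proj₂ Bᵀ-inverse)) ⟩
    B *M ((L *M D) *M idM)
      ≈⟨ *M-cong (≈m-refl {A = B}) (*M-identityʳ (L *M D)) ⟩
    B *M (L *M D)
      ≈⟨ *M-assoc B L D ⟨
    (B *M L) *M D
      ≈⟨ *M-cong (proj₁ B-inverse) (≈m-refl {A = D}) ⟩
    idM *M D
      ≈⟨ *M-identityˡ D ⟩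
    D ∎
    where open ≈m-Reasoning

-- Reversing the order of rows and columns simultaneously (i ↦ n-1-i)
-- preserves matrix products, hence equivalence.

reverse : ∀ {n} → Mat n → Mat n
reverse A i j = A (Fin.opposite i) (Fin.opposite j)

reverse-*M : ∀ {n} (A B : Mat n) → (reverse A *M reverse B) ≈m reverse (A *M B)
reverse-*M {n} A B i j = sumFin-reverse n (λ k → A (Fin.opposite i) k *P B k (Fin.opposite j))

opposite-injective : ∀ {n} {i j : Fin n} → Fin.opposite i ≡ Fin.opposite j → i ≡ j
opposite-injective {i = i} {j} e = trans (sym (FinP.opposite-involutive i))
  (trans (cong Fin.opposite e) (FinP.opposite-involutive j))

reverse-diagM : ∀ {n} (d : Fin n → Poly) → reverse (diagM d) ≈m diagM (λ t → d (Fin.opposite t))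
reverse-diagM d i j with Fin.opposite i Fin.≟ Fin.opposite j | i Fin.≟ j
... | yes _     | yes _   = ≈-refl
... | no  _     | no  _   = ≈-refl
... | yes oi≡oj | no  i≢j = ⊥-elim (i≢j (opposite-injective oi≡oj))
... | no  oi≢oj | yes i≡j = ⊥-elim (oi≢oj (cong Fin.opposite i≡j))

reverse-idM : ∀ {n} → reverse (idM {n}) ≈m idM
reverse-idM i j = ≈-trans (≡⇒≈ (idM≡diagM (Fin.opposite i) (Fin.opposite j)))
  (≈-trans (reverse-diagM (λ _ → 1P) i j) (≡⇒≈ (sym (idM≡diagM i j))))

reverse-inverse : ∀ {n} (A B : Mat n) → (A *M B) ≈M idM → (reverse A *M reverse B) ≈m idM
reverse-inverse A B AB≈1 i j =
  ≈-trans (reverse-*M A B i j) (≈-trans (coeffwise (AB≈1 _ _)) (reverse-idM i j))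

EquivTo-reverse : ∀ {n} {A D : Mat n} → EquivTo A D → EquivTo (reverse A) (reverse D)
EquivTo-reverse {A = A} {D} (P , Q , (P' , PP' , P'P) , (Q' , QQ' , Q'Q) , PAQ≈D) =
  equivTo {A = reverse A} {D = reverse D} (reverse P) (reverse P') (reverse Q) (reverse Q')
    (reverse-inverse P P' PP' , reverse-inverse P' P P'P)
    (reverse-inverse Q Q' QQ' , reverse-inverse Q' Q Q'Q)
    (λ i j → ≈-trans (*M-cong (reverse-*M P A) (≈m-refl {A = reverse Q}) i j)
             (≈-trans (reverse-*M (P *M A) Q i j) (coeffwise (PAQ≈D _ _))))

EquivTo-cong : ∀ {n} {A A' D D' : Mat n} → A' ≈m A → D ≈m D' → EquivTo A D → EquivTo A' D'
EquivTo-cong A'≈A D≈D' (P , Q , (P' , PP' , P'P) , (Q' , QQ' , Q'Q) , PAQ≈D) =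
  equivTo P P' Q Q' (≈M⇒≈m PP' , ≈M⇒≈m P'P) (≈M⇒≈m QQ' , ≈M⇒≈m Q'Q)
    (λ i j → ≈-trans (*M-cong (*M-cong (≈m-refl {A = P}) A'≈A) (≈m-refl {A = Q}) i j)
             (≈-trans (coeffwise (PAQ≈D i j)) (D≈D' i j)))

-- Paths take steps ±1 and stay at heights ≥ 0; a
-- down step from height k+1 to k has weight q^k, an up step weight 1.
-- pathsTo0 n h   : total weight of paths of length n from height h to 0,
--                  classified by the first step;
-- pathsFrom0 n h : total weight of paths of length n from height 0 to h,
--                  classified by the last step.

pathsTo0 : ℕ → ℕ → Poly
pathsTo0 zero    zero    = 1P
pathsTo0 zero    (suc h) = 0P
pathsTo0 (suc n) zero    = pathsTo0 n 1
pathsTo0 (suc n) (suc h) = pathsTo0 n (suc (suc h)) +P (qPow h *P pathsTo0 n h)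

pathsFrom0 : ℕ → ℕ → Poly
pathsFrom0 zero    zero    = 1P
pathsFrom0 zero    (suc h) = 0P
pathsFrom0 (suc n) zero    = pathsFrom0 n 1
pathsFrom0 (suc n) (suc h) = pathsFrom0 n h +P (qPow (suc h) *P pathsFrom0 n (suc (suc h)))

-- a path of length n cannot bridge a height difference larger than n
pathsTo0-high : ∀ n h → n < h → pathsTo0 n h ≈ 0P
pathsTo0-high zero    (suc h) _         = ≈-refl
pathsTo0-high (suc n) (suc h) (s≤s n<h) = +P-zero
  (pathsTo0-high n (suc (suc h)) (NP.m<n⇒m<1+n (NP.m<n⇒m<1+n n<h)))
  (*P-annihilʳ (qPow h) (pathsTo0-high n h n<h))

pathsFrom0-high : ∀ n h → n < h → pathsFrom0 n h ≈ 0P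
pathsFrom0-high zero    (suc h) _         = ≈-refl
pathsFrom0-high (suc n) (suc h) (s≤s n<h) = +P-zero
  (pathsFrom0-high n h n<h)
  (*P-annihilʳ (qPow (suc h)) (pathsFrom0-high n (suc (suc h)) (NP.m<n⇒m<1+n (NP.m<n⇒m<1+n n<h))))

-- the only path from 0 to n in n steps goes straight up
pathsFrom0-diag : ∀ n → pathsFrom0 n n ≈ 1P
pathsFrom0-diag zero    = ≈-refl
pathsFrom0-diag (suc n) = ≈-trans
  (+P-cong (pathsFrom0-diag n)
           (*P-annihilʳ (qPow (suc n)) (pathsFrom0-high n (suc (suc n)) (NP.m<n⇒m<1+n (NP.n<1+n n)))))
  (+P-identityʳ 1P)

pathsFrom0-even-odd : ∀ i k → pathsFrom0 (double i) (suc (double k)) ≈ 0P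
pathsFrom0-odd-even : ∀ i k → pathsFrom0 (suc (double i)) (double k) ≈ 0P
pathsFrom0-even-odd zero    k = ≈-refl
pathsFrom0-even-odd (suc i) k = +P-zero (pathsFrom0-odd-even i k)
  (*P-annihilʳ (qPow (suc (double k))) (pathsFrom0-odd-even i (suc k)))
pathsFrom0-odd-even i zero    = pathsFrom0-even-odd i 0
pathsFrom0-odd-even i (suc k) = +P-zero (pathsFrom0-even-odd i k)
  (*P-annihilʳ (qPow (suc (suc (double k)))) (pathsFrom0-even-odd i (suc k)))

choose2 : ℕ → ℕ
choose2 zero    = 0
choose2 (suc h) = h ℕ.+ choose2 h

-- Reading a path backwards turns its down steps into up steps; the weights
-- differ by the factor q^(0+1+⋯+(h-1)) = q^binom(h,2).
pathsTo0-reverse : ∀ n h → pathsTo0 n h ≈ (qPow (choose2 h) *P pathsFrom0 n h)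
pathsTo0-reverse zero    zero    = ≈-refl
pathsTo0-reverse zero    (suc h) = ≈-sym (*P-zeroʳ (qPow (choose2 (suc h))))
pathsTo0-reverse (suc n) zero    = pathsTo0-reverse n 1
pathsTo0-reverse (suc n) (suc h) = begin
  pathsTo0 n (suc (suc h)) +P (qPow h *P pathsTo0 n h)
    ≈⟨ +P-cong (pathsTo0-reverse n (suc (suc h))) (*P-congʳ (qPow h) (pathsTo0-reverse n h)) ⟩
  (qPow (suc h ℕ.+ c) *P F (suc (suc h))) +P (qPow h *P (qPow (choose2 h) *P F h))
    ≈⟨ +P-comm (qPow (suc h ℕ.+ c) *P F (suc (suc h))) _ ⟩
  (qPow h *P (qPow (choose2 h) *P F h)) +P (qPow (suc h ℕ.+ c) *P F (suc (suc h)))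
    ≈⟨ +P-cong (≈-trans (≈-sym (*P-assoc (qPow h) (qPow (choose2 h)) (F h)))
                        (*P-congˡ (F h) (≈-sym (qPow-+ h (choose2 h)))))
               (≈-trans (*P-congˡ (F (suc (suc h))) (≈-trans (qPow-+ (suc h) c) (*P-comm (qPow (suc h)) _)))
                        (*P-assoc (qPow c) (qPow (suc h)) _)) ⟩
  (qPow c *P F h) +P (qPow c *P (qPow (suc h) *P F (suc (suc h))))
    ≈⟨ *P-distribˡ (qPow c) (F h) _ ⟨
  qPow c *P (F h +P (qPow (suc h) *P F (suc (suc h)))) ∎
  where
  open ≈-Reasoning
  c : ℕ
  c = choose2 (suc h)
  F : ℕ → Poly
  F = pathsFrom0 n

-- Moving the cut point of a path of length (i+1)+j one step to the left:
-- both sides sum over the position of the path at times i and i+1.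
shift-cut : ∀ i j M → i < M →
  sumBelow (suc M) (λ h → pathsFrom0 (suc i) h *P pathsTo0 j h) ≈
  sumBelow (suc M) (λ h → pathsFrom0 i h *P pathsTo0 (suc j) h)
shift-cut i j M i<M = ≈-trans left (≈-sym right)
  where
  -- the two ways of crossing between times i and i+1: up from h, down to h
  up down : ℕ → Poly
  up   h = pathsFrom0 i h *P pathsTo0 j (suc h)
  down h = pathsFrom0 i (suc h) *P (qPow h *P pathsTo0 j h)
  drop-last : ∀ f → f M ≈ 0P → sumBelow (suc M) f ≈ sumBelow M f
  drop-last f fM≈0 = ≈-trans (sumBelow-last M f)
    (≈-trans (+P-cong (≈-refl {sumBelow M f}) fM≈0) (+P-identityʳ (sumBelow M f)))
  up-M : up M ≈ 0P
  up-M = *P-annihilˡ (pathsTo0 j (suc M)) (pathsFrom0-high i M i<M)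
  down-M : down M ≈ 0P
  down-M = *P-annihilˡ (qPow M *P pathsTo0 j M) (pathsFrom0-high i (suc M) (NP.m<n⇒m<1+n i<M))
  left : sumBelow (suc M) (λ h → pathsFrom0 (suc i) h *P pathsTo0 j h) ≈ (sumBelow M up +P sumBelow M down)
  left = begin
    (pathsFrom0 i 1 *P pathsTo0 j 0) +P
      sumBelow M (λ h → (pathsFrom0 i h +P (qPow (suc h) *P pathsFrom0 i (suc (suc h)))) *P pathsTo0 j (suc h))
      ≈⟨ +P-cong (*P-congʳ (pathsFrom0 i 1) (≈-sym (*P-identityˡ (pathsTo0 j 0))))
                 (sumBelow-cong M (λ h _ → ≈-trans
                   (*P-distribʳ (pathsFrom0 i h) (qPow (suc h) *P pathsFrom0 i (suc (suc h))) (pathsTo0 j (suc h)))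
                   (+P-cong (≈-refl {up h})
                            (reassoc (qPow (suc h)) (pathsFrom0 i (suc (suc h))) (pathsTo0 j (suc h)))))) ⟩
    down 0 +P sumBelow M (λ h → up h +P down (suc h))
      ≈⟨ +P-cong (≈-refl {down 0}) (sumFin-+ M (λ h → up (toℕ h)) (λ h → down (suc (toℕ h)))) ⟩
    down 0 +P (sumBelow M up +P sumBelow M (λ h → down (suc h)))
      ≈⟨ x∙yz≈y∙xz (down 0) (sumBelow M up) _ ⟩
    sumBelow M up +P sumBelow (suc M) down
      ≈⟨ +P-cong (≈-refl {sumBelow M up}) (drop-last down down-M) ⟩
    sumBelow M up +P sumBelow M down ∎
    where
    open ≈-Reasoning
    reassoc : ∀ x y z → ((x *P y) *P z) ≈ (y *P (x *P z))
    reassoc x y z = ≈-trans (*P-congˡ z (*P-comm x y)) (*P-assoc y x z)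
  right : sumBelow (suc M) (λ h → pathsFrom0 i h *P pathsTo0 (suc j) h) ≈ (sumBelow M up +P sumBelow M down)
  right = begin
    up 0 +P sumBelow M (λ h → pathsFrom0 i (suc h) *P (pathsTo0 j (suc (suc h)) +P (qPow h *P pathsTo0 j h)))
      ≈⟨ +P-cong (≈-refl {up 0})
           (≈-trans (sumBelow-cong M (λ h _ →
                      *P-distribˡ (pathsFrom0 i (suc h)) (pathsTo0 j (suc (suc h))) (qPow h *P pathsTo0 j h)))
                    (sumFin-+ M (λ h → up (suc (toℕ h))) (λ h → down (toℕ h)))) ⟩
    up 0 +P (sumBelow M (λ h → up (suc h)) +P sumBelow M down)
      ≈⟨ +P-assoc (up 0) _ _ ⟨
    sumBelow (suc M) up +P sumBelow M down
      ≈⟨ +P-cong (drop-last up up-M) (≈-refl {sumBelow M down}) ⟩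
    sumBelow M up +P sumBelow M down ∎
    where open ≈-Reasoning

-- Cutting a path from 0 to 0 of length i+j at time i, where it is at some
-- height h ≤ i < N.  This is the path-counting form of L D Lᵀ.
cut-paths : ∀ i j N → i < N → sumBelow N (λ h → pathsFrom0 i h *P pathsTo0 j h) ≈ pathsTo0 (i ℕ.+ j) 0
cut-paths zero    j (suc M) _ = ≈-trans
  (+P-cong (*P-identityˡ (pathsTo0 j 0)) (sumBelow-zero M (λ _ _ → ≈-refl)))
  (+P-identityʳ (pathsTo0 j 0))
cut-paths (suc i) j (suc M) (s≤s i<M) = begin
  sumBelow (suc M) (λ h → pathsFrom0 (suc i) h *P pathsTo0 j h)
    ≈⟨ shift-cut i j M i<M ⟩
  sumBelow (suc M) (λ h → pathsFrom0 i h *P pathsTo0 (suc j) h)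
    ≈⟨ cut-paths i (suc j) (suc M) (NP.m<n⇒m<1+n i<M) ⟩
  pathsTo0 (i ℕ.+ suc j) 0
    ≡⟨ cong (λ t → pathsTo0 t 0) (NP.+-suc i j) ⟩
  pathsTo0 (suc i ℕ.+ j) 0 ∎
  where open ≈-Reasoning

ΣL : {X : Set} → List X → (X → Poly) → Poly
ΣL L f = sumP (map f L)

ΣL-cong : {X : Set} (L : List X) {f g : X → Poly} → (∀ x → f x ≈ g x) → ΣL L f ≈ ΣL L g
ΣL-cong []      e = ≈-refl
ΣL-cong (x ∷ L) e = +P-cong (e x) (ΣL-cong L e)

ΣL-zero : {X : Set} (L : List X) → ΣL L (λ _ → 0P) ≈ 0P
ΣL-zero []      = ≈-refl
ΣL-zero (x ∷ L) = ΣL-zero L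

ΣL-*ˡ : {X : Set} (L : List X) (p : Poly) (f : X → Poly) → (p *P ΣL L f) ≈ ΣL L (λ x → p *P f x)
ΣL-*ˡ []      p f = *P-zeroʳ p
ΣL-*ˡ (x ∷ L) p f = ≈-trans (*P-distribˡ p (f x) _) (+P-cong (≈-refl {p *P f x}) (ΣL-*ˡ L p f))

ΣL-++ : {X : Set} (L₁ L₂ : List X) (f : X → Poly) → ΣL (L₁ ++ L₂) f ≈ (ΣL L₁ f +P ΣL L₂ f)
ΣL-++ []       L₂ f = ≈-refl
ΣL-++ (x ∷ L₁) L₂ f = ≈-trans (+P-cong (≈-refl {f x}) (ΣL-++ L₁ L₂ f)) (≈-sym (+P-assoc (f x) _ _))

ΣL-concatMap : {X Y : Set} (g : X → List Y) (L : List X) (f : Y → Poly) →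
  ΣL (concatMap g L) f ≈ ΣL L (λ x → ΣL (g x) f)
ΣL-concatMap g []      f = ≈-refl
ΣL-concatMap g (x ∷ L) f =
  ≈-trans (ΣL-++ (g x) (concatMap g L) f) (+P-cong (≈-refl {ΣL (g x) f}) (ΣL-concatMap g L f))

ΣL-applyUpTo : ∀ (g : ℕ → ℕ) b (f : ℕ → Poly) → ΣL (applyUpTo g b) f ≡ sumBelow b (λ y → f (g y))
ΣL-applyUpTo g zero    f = refl
ΣL-applyUpTo g (suc b) f = cong (f (g 0) +P_) (ΣL-applyUpTo (λ y → g (suc y)) b f)

ΣL-filter : {X : Set} (c : X → Bool) (L : List X) (f : X → Poly) →
  ΣL (filter (λ x → BoolP.T? (c x)) L) f ≈ ΣL L (λ x → if c x then f x else 0P)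
ΣL-filter c []      f = ≈-refl
ΣL-filter c (x ∷ L) f with c x
... | true  = +P-cong (≈-refl {f x}) (ΣL-filter c L f)
... | false = ΣL-filter c L f

ΣL-allLists-suc : ∀ n b (f : List ℕ → Poly) →
  ΣL (allLists (suc n) b) f ≈ sumBelow b (λ x → ΣL (allLists n b) (λ μ → f (x ∷ μ)))
ΣL-allLists-suc n b f = ≈-trans (ΣL-concatMap (λ x → map (x ∷_) (allLists n b)) (upTo b) f)
  (≈-trans (≡⇒≈ (ΣL-applyUpTo (λ y → y) b (λ x → ΣL (map (x ∷_) (allLists n b)) f)))
           (sumBelow-cong b (λ x _ → ≡⇒≈ (cong sumP (sym (ListP.map-∘ {g = f} {f = x ∷_} (allLists n b)))))))

ΣL-allLists-cong : ∀ n b {f g : List ℕ → Poly} → (∀ μ → length μ ≡ n → f μ ≈ g μ) →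
  ΣL (allLists n b) f ≈ ΣL (allLists n b) g
ΣL-allLists-cong zero    b e = +P-cong (e [] refl) ≈-refl
ΣL-allLists-cong (suc n) b {f} {g} e = begin
  ΣL (allLists (suc n) b) f                           ≈⟨ ΣL-allLists-suc n b f ⟩
  sumBelow b (λ x → ΣL (allLists n b) (λ μ → f (x ∷ μ)))
    ≈⟨ sumBelow-cong b (λ x _ → ΣL-allLists-cong n b (λ μ len → e (x ∷ μ) (cong suc len))) ⟩
  sumBelow b (λ x → ΣL (allLists n b) (λ μ → g (x ∷ μ))) ≈⟨ ΣL-allLists-suc n b g ⟨
  ΣL (allLists (suc n) b) g                           ∎
  where open ≈-Reasoning

-- A list μ of length n with
-- fitsUnder n u μ is a partition fitting under the staircase (n, n-1, …, 1)
-- whose first part is at most u; coSize n μ counts the cells of the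
-- staircase outside μ.

fitsUnder : ℕ → ℕ → List ℕ → Bool
fitsUnder n u μ = decreasing (u ∷ μ) ∧ underStair n μ

coSize : ℕ → List ℕ → ℕ
coSize c []       = 0
coSize c (x ∷ xs) = (c ∸ x) ℕ.+ coSize (c ∸ 1) xs

stairGF : ℕ → ℕ → ℕ → Poly
stairGF n b u = ΣL (allLists n b) (λ μ → if fitsUnder n u μ then qPow (coSize n μ) else 0P)

fitsUnder-∷ : ∀ n u x μ →
  fitsUnder (suc n) u (x ∷ μ) ≡ ((x ≤ᵇ u) ∧ (x ≤ᵇ suc n)) ∧ fitsUnder n x μ
fitsUnder-∷ n u x μ with x ≤ᵇ u | x ≤ᵇ suc n
... | false | _     = refl
... | true  | true  = refl
... | true  | false = BoolP.∧-zeroʳ (decreasing (x ∷ μ))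

-- under the staircase (n, …, 1) the first part is automatically at most n
fitsUnder-staircase : ∀ n μ → fitsUnder n n μ ≡ inStaircase (suc n) μ
fitsUnder-staircase n []      = refl
fitsUnder-staircase n (x ∷ μ) with x ≤ᵇ n
... | true  = refl
... | false = sym (BoolP.∧-zeroʳ (decreasing (x ∷ μ)))

ΣL-guarded-factor : {X : Set} (L : List X) (c : Bool) (a : ℕ) (d : X → Bool) (e : X → ℕ) →
  ΣL L (λ μ → if c ∧ d μ then qPow (a ℕ.+ e μ) else 0P) ≈
  (if c then qPow a *P ΣL L (λ μ → if d μ then qPow (e μ) else 0P) else 0P)
ΣL-guarded-factor L false a d e = ΣL-zero L
ΣL-guarded-factor L true  a d e = ≈-trans (ΣL-cong L factor) (≈-sym (ΣL-*ˡ L (qPow a) _))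
  where
  factor : ∀ μ → (if d μ then qPow (a ℕ.+ e μ) else 0P) ≈ (qPow a *P (if d μ then qPow (e μ) else 0P))
  factor μ with d μ
  ... | true  = qPow-+ a (e μ)
  ... | false = ≈-sym (*P-zeroʳ (qPow a))

-- transfer recursion: condition on the first part x
stairGF-step : ∀ n b u → stairGF (suc n) b u ≈
  sumBelow b (λ x → if (x ≤ᵇ u) ∧ (x ≤ᵇ suc n) then qPow (suc n ∸ x) *P stairGF n b x else 0P)
stairGF-step n b u = ≈-trans (ΣL-allLists-suc n b _) (sumBelow-cong b (λ x _ →
  ≈-trans (ΣL-cong (allLists n b) (λ μ → ≡⇒≈
            (cong (λ c → if c then qPow (coSize (suc n) (x ∷ μ)) else 0P) (fitsUnder-∷ n u x μ))))
          (ΣL-guarded-factor (allLists n b) ((x ≤ᵇ u) ∧ (x ≤ᵇ suc n)) (suc n ∸ x) (fitsUnder n x) (coSize n))))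

-- Unrolling the recursion of pathsTo0 along the first up-steps: a path of
-- length M+v+1 from height M-v+1 first climbs to some height M-y+1 (y ≤ v)
-- and then takes its first down step.
pathsTo0-unroll : ∀ M v → v ≤ M →
  sumBelow (suc v) (λ y → qPow (M ∸ y) *P pathsTo0 (M ℕ.+ y) (M ∸ y)) ≈
  pathsTo0 (suc (M ℕ.+ v)) (suc (M ∸ v))
pathsTo0-unroll M zero    _   = ≈-trans (+P-identityʳ _)
  (≈-sym (+P-cong (pathsTo0-high (M ℕ.+ 0) (suc (suc M))
                                 (s≤s (NP.m≤n⇒m≤1+n (NP.≤-reflexive (NP.+-identityʳ M)))))
                  (≈-refl {qPow M *P pathsTo0 (M ℕ.+ 0) M})))
pathsTo0-unroll M (suc v) v<M = begin
  sumBelow (suc (suc v)) term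
    ≈⟨ sumBelow-last (suc v) term ⟩
  sumBelow (suc v) term +P term (suc v)
    ≈⟨ +P-cong (pathsTo0-unroll M v (NP.<⇒≤ v<M)) (≈-refl {term (suc v)}) ⟩
  pathsTo0 (suc (M ℕ.+ v)) (suc (M ∸ v)) +P (qPow h *P pathsTo0 (M ℕ.+ suc v) h)
    ≡⟨ cong₂ (λ s t → pathsTo0 (suc (M ℕ.+ v)) (suc s) +P (qPow h *P pathsTo0 t h))
             (NP.+-∸-assoc 1 v<M) (NP.+-suc M v) ⟩
  pathsTo0 (suc (M ℕ.+ v)) (suc (suc h)) +P (qPow h *P pathsTo0 (suc (M ℕ.+ v)) h)
    ≡⟨ cong (λ t → pathsTo0 (suc t) (suc h)) (NP.+-suc M v) ⟨
  pathsTo0 (suc (M ℕ.+ suc v)) (suc h) ∎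
  where
  open ≈-Reasoning
  term : ℕ → Poly
  term y = qPow (M ∸ y) *P pathsTo0 (M ℕ.+ y) (M ∸ y)
  h : ℕ
  h = M ∸ suc v

≤ᵇ-true : ∀ {y x} → y ≤ x → (y ≤ᵇ x) ≡ true
≤ᵇ-true y≤x = Equivalence.to BoolP.T-≡ (NP.≤⇒≤ᵇ y≤x)

≤ᵇ-false : ∀ {y x} → x < y → (y ≤ᵇ x) ≡ false
≤ᵇ-false {y} {x} x<y with y ≤ᵇ x in eq
... | false = refl
... | true  = ⊥-elim (NP.<⇒≱ x<y (NP.≤ᵇ⇒≤ y x (Equivalence.from BoolP.T-≡ eq)))

sumBelow-guarded : ∀ b v (c : ℕ → Bool) (g : ℕ → Poly) → v < b →
  (∀ y → y ≤ v → c y ≡ true) → (∀ y → v < y → c y ≡ false) →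
  sumBelow b (λ y → if c y then g y else 0P) ≈ sumBelow (suc v) g
sumBelow-guarded b v c g v<b holds fails =
  Eq.subst (λ t → sumBelow t guarded ≈ sumBelow (suc v) g) (NP.m+[n∸m]≡n v<b)
    (≈-trans (sumBelow-extend (suc v) (b ∸ suc v) guarded (λ y v<y _ → guard-is y (fails y v<y)))
             (sumBelow-cong (suc v) (λ y y≤v → guard-is y (holds y (NP.≤-pred y≤v)))))
  where
  guarded : ℕ → Poly
  guarded y = if c y then g y else 0P
  guard-is : ∀ y {t} → c y ≡ t → guarded y ≈ (if t then g y else 0P)
  guard-is y c≡t = ≡⇒≈ (cong (λ t → if t then g y else 0P) c≡t)

-- Partitions under the staircase (m+1, …, 1) with first part ≤ x correspond
-- to paths from height m+1-x to 0 of length m+1+x.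
stairGF-paths : ∀ m b x → x ≤ suc m → suc m ≤ b →
  stairGF m b x ≈ pathsTo0 (suc m ℕ.+ x) (suc m ∸ x)
stairGF-paths zero    b zero          _         _   = ≈-refl
stairGF-paths zero    b (suc zero)    _         _   = ≈-refl
stairGF-paths zero    b (suc (suc x)) (s≤s ())  _
stairGF-paths (suc m) b x             x≤M+1     M<b =
  ≈-trans (stairGF-step m b x) (by-cases (NP.m≤n⇒m<n∨m≡n x≤M+1))
  where
  M : ℕ
  M = suc m
  term : ℕ → Poly
  term y = qPow (M ∸ y) *P stairGF m b y
  guard : ℕ → Bool
  guard y = (y ≤ᵇ x) ∧ (y ≤ᵇ M)
  sum-paths : ∀ v → v ≤ M → sumBelow (suc v) term ≈ pathsTo0 (suc (M ℕ.+ v)) (suc (M ∸ v))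
  sum-paths v v≤M = ≈-trans
    (sumBelow-cong (suc v) (λ y y≤v → *P-congʳ (qPow (M ∸ y))
      (stairGF-paths m b y (NP.≤-trans (NP.≤-pred y≤v) v≤M) (NP.<⇒≤ M<b))))
    (pathsTo0-unroll M v v≤M)
  by-cases : x < suc M ⊎ x ≡ suc M →
    sumBelow b (λ y → if guard y then term y else 0P) ≈ pathsTo0 (suc M ℕ.+ x) (suc M ∸ x)
  -- x ≤ M: the guard is y ≤ x
  by-cases (inj₁ (s≤s x≤M)) = ≈-trans
    (sumBelow-guarded b x guard term (NP.≤-trans (s≤s x≤M) M<b)
      (λ y y≤x → cong₂ _∧_ (≤ᵇ-true y≤x) (≤ᵇ-true (NP.≤-trans y≤x x≤M)))
      (λ y x<y → cong (_∧ (y ≤ᵇ M)) (≤ᵇ-false x<y)))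
    (≈-trans (sum-paths x x≤M) (≡⇒≈ (cong (pathsTo0 (suc (M ℕ.+ x))) (sym (NP.+-∸-assoc 1 x≤M)))))
  -- x = M+1: the guard is y ≤ M, and both sides count paths from height 1
  by-cases (inj₂ refl) = ≈-trans
    (sumBelow-guarded b M guard term M<b
      (λ y y≤M → cong₂ _∧_ (≤ᵇ-true (NP.m≤n⇒m≤1+n y≤M)) (≤ᵇ-true y≤M))
      (λ y M<y → trans (cong ((y ≤ᵇ suc M) ∧_) (≤ᵇ-false M<y)) (BoolP.∧-zeroʳ _)))
    (≈-trans (sum-paths M NP.≤-refl) (≡⇒≈ (begin
      pathsTo0 (suc (M ℕ.+ M)) (suc (M ∸ M))
        ≡⟨ cong (λ t → pathsTo0 (suc (M ℕ.+ M)) (suc t)) (NP.n∸n≡0 M) ⟩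
      pathsTo0 (suc (M ℕ.+ M)) 1
        ≡⟨ cong (λ t → pathsTo0 t 1) (NP.+-suc M M) ⟨
      pathsTo0 (M ℕ.+ suc M) 1
        ≡⟨ cong (pathsTo0 (suc (M ℕ.+ suc M))) (NP.n∸n≡0 m) ⟨
      pathsTo0 (suc M ℕ.+ suc M) (suc M ∸ suc M) ∎)))
    where open Eq.≡-Reasoning

choose2-C : ∀ h → choose2 h ≡ h C 2
choose2-C zero    = refl
choose2-C (suc h) = begin
  h ℕ.+ choose2 h   ≡⟨ cong₂ ℕ._+_ (sym (nC1≡n h)) (choose2-C h) ⟩
  h C 1 ℕ.+ h C 2   ≡⟨ nCk+nC[k+1]≡[n+1]C[k+1] h 1 ⟩
  suc h C 2         ∎
  where open Eq.≡-Reasoning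

-- μ and its complement fill the staircase (n, …, 1), n = length μ
coSize-size : ∀ μ → T (underStair (length μ) μ) →
  coSize (length μ) μ ℕ.+ size μ ≡ choose2 (suc (length μ))
coSize-size []       _     = refl
coSize-size (x ∷ xs) under = begin
  ((c ∸ x) ℕ.+ coSize (length xs) xs) ℕ.+ (x ℕ.+ size xs)
    ≡⟨ solve 4 (λ a f y s → (a :+ f) :+ (y :+ s) := (a :+ y) :+ (f :+ s)) refl
               (c ∸ x) (coSize (length xs) xs) x (size xs) ⟩
  ((c ∸ x) ℕ.+ x) ℕ.+ (coSize (length xs) xs ℕ.+ size xs)
    ≡⟨ cong₂ ℕ._+_ (NP.m∸n+n≡m (NP.≤ᵇ⇒≤ x c x≤c)) (coSize-size xs xs-under) ⟩
  c ℕ.+ choose2 c ∎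
  where
  open Eq.≡-Reasoning
  open +-*-Solver
  c : ℕ
  c = suc (length xs)
  x≤c : T (x ≤ᵇ c)
  x≤c = proj₁ (Equivalence.to BoolP.T-∧ under)
  xs-under : T (underStair (length xs) xs)
  xs-under = proj₂ (Equivalence.to BoolP.T-∧ under)

staircase-term : ∀ n μ → length μ ≡ n →
  (if inStaircase (suc n) μ then qPow ((suc n C 2) ∸ size μ) else 0P) ≈
  (if fitsUnder n n μ then qPow (coSize n μ) else 0P)
staircase-term .(length μ) μ refl rewrite fitsUnder-staircase (length μ) μ
  with inStaircase (suc (length μ)) μ in fits
... | false = ≈-refl
... | true  = ≡⇒≈ (cong qPow (begin
  (suc l C 2) ∸ size μ                   ≡⟨ cong (_∸ size μ) (choose2-C (suc l)) ⟨
  choose2 (suc l) ∸ size μ               ≡⟨ cong (_∸ size μ) (coSize-size μ under) ⟨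
  (coSize l μ ℕ.+ size μ) ∸ size μ       ≡⟨ NP.m+n∸n≡m (coSize l μ) (size μ) ⟩
  coSize l μ                             ∎))
  where
  open Eq.≡-Reasoning
  l : ℕ
  l = length μ
  under : T (underStair l μ)
  under = proj₂ (Equivalence.to BoolP.T-∧ (Equivalence.from BoolP.T-≡ fits))

qCat-paths : ∀ k → qCat k ≈ pathsTo0 (double k) 0
qCat-paths zero    = ≈-refl
qCat-paths (suc n) = begin
  qCat (suc n)
    ≈⟨ ΣL-filter (inStaircase (suc n)) (allLists n (suc n)) (λ μ → qPow ((suc n C 2) ∸ size μ)) ⟩
  ΣL (allLists n (suc n)) (λ μ → if inStaircase (suc n) μ then qPow ((suc n C 2) ∸ size μ) else 0P)
    ≈⟨ ΣL-allLists-cong n (suc n) (staircase-term n) ⟩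
  stairGF n (suc n) n
    ≈⟨ stairGF-paths n (suc n) n (NP.n≤1+n n) NP.≤-refl ⟩
  pathsTo0 (suc n ℕ.+ n) (suc n ∸ n)
    ≡⟨ cong₂ pathsTo0 (cong suc (n+n≡double n)) (NP.m+n∸n≡m 1 n) ⟩
  pathsTo0 (double (suc n)) 0 ∎
  where open ≈-Reasoning

-- Cutting a Dyck path of length
-- i+j at time i gives C̃ as a sum over the height there; for even (resp.
-- odd) i and j only even (resp. odd) heights occur, and reading the second
-- half backwards gives the factorisation H = L D Lᵀ.

dyck-cut : ∀ n i j → i < double n → pathsTo0 (i ℕ.+ j) 0 ≈
  sumBelow n (λ k → (pathsFrom0 i (double k) *P pathsTo0 j (double k)) +P
                    (pathsFrom0 i (suc (double k)) *P pathsTo0 j (suc (double k))))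
dyck-cut n i j i<2n = ≈-trans (≈-sym (cut-paths i j (double n) i<2n))
  (sumBelow-pairs n (λ h → pathsFrom0 i h *P pathsTo0 j h))

hankel-even-entry : ∀ n a b → a < n → qCat (a ℕ.+ b) ≈ sumBelow n (λ k →
  pathsFrom0 (double a) (double k) *P (qPow (choose2 (double k)) *P pathsFrom0 (double b) (double k)))
hankel-even-entry n a b a<n = begin
  qCat (a ℕ.+ b)                        ≈⟨ qCat-paths (a ℕ.+ b) ⟩
  pathsTo0 (double (a ℕ.+ b)) 0         ≡⟨ cong (λ t → pathsTo0 t 0) (double-+ a b) ⟩
  pathsTo0 (double a ℕ.+ double b) 0    ≈⟨ dyck-cut n (double a) (double b) (double-mono-< a<n) ⟩
  sumBelow n (λ k → (F (double k) *P Z (double k)) +P (F (suc (double k)) *P Z (suc (double k))))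
    ≈⟨ sumBelow-cong n (λ k _ → ≈-trans
         (+P-cong (≈-refl {F (double k) *P Z (double k)})
                  (*P-annihilˡ (Z (suc (double k))) (pathsFrom0-even-odd a k)))
         (≈-trans (+P-identityʳ _) (*P-congʳ (F (double k)) (pathsTo0-reverse (double b) (double k))))) ⟩
  sumBelow n (λ k → F (double k) *P (qPow (choose2 (double k)) *P pathsFrom0 (double b) (double k))) ∎
  where
  open ≈-Reasoning
  F Z : ℕ → Poly
  F = pathsFrom0 (double a)
  Z = pathsTo0 (double b)

hankel-odd-entry : ∀ n a b → a < n → qCat (suc (a ℕ.+ b)) ≈ sumBelow n (λ k →
  pathsFrom0 (suc (double a)) (suc (double k)) *P
    (qPow (choose2 (suc (double k))) *P pathsFrom0 (suc (double b)) (suc (double k))))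
hankel-odd-entry n a b a<n = begin
  qCat (suc (a ℕ.+ b))                      ≈⟨ qCat-paths (suc (a ℕ.+ b)) ⟩
  pathsTo0 (suc (suc (double (a ℕ.+ b)))) 0
    ≡⟨ cong (λ t → pathsTo0 (suc t) 0) (trans (cong suc (double-+ a b)) (sym (NP.+-suc (double a) (double b)))) ⟩
  pathsTo0 (suc (double a) ℕ.+ suc (double b)) 0
    ≈⟨ dyck-cut n (suc (double a)) (suc (double b)) (double-mono-≤ a<n) ⟩
  sumBelow n (λ k → (F (double k) *P Z (double k)) +P (F (suc (double k)) *P Z (suc (double k))))
    ≈⟨ sumBelow-cong n (λ k _ → ≈-trans
         (+P-cong (*P-annihilˡ (Z (double k)) (pathsFrom0-odd-even a k))
                  (≈-refl {F (suc (double k)) *P Z (suc (double k))}))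
         (*P-congʳ (F (suc (double k))) (pathsTo0-reverse (suc (double b)) (suc (double k))))) ⟩
  sumBelow n (λ k → F (suc (double k)) *P
    (qPow (choose2 (suc (double k))) *P pathsFrom0 (suc (double b)) (suc (double k)))) ∎
  where
  open ≈-Reasoning
  F Z : ℕ → Poly
  F = pathsFrom0 (suc (double a))
  Z = pathsTo0 (suc (double b))

pathsFrom0-unitriangular : ∀ n (f : ℕ → ℕ) → (∀ {a b} → a < b → f a < f b) →
  Unitriangular {n} (λ i k → pathsFrom0 (f (toℕ i)) (f (toℕ k)))
pathsFrom0-unitriangular n f f-mono =
  (λ i → pathsFrom0-diag (f (toℕ i))) , (λ i j i<j → pathsFrom0-high _ _ (f-mono i<j))

hankel-even-equiv : ∀ n →
  EquivTo (λ i j → qCat (toℕ i ℕ.+ toℕ j)) (diagM (λ k → qPow (choose2 (double (toℕ k)))))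
hankel-even-equiv n = ldl-equiv n _ _ _
  (pathsFrom0-unitriangular n double double-mono-<)
  (λ i j → hankel-even-entry n (toℕ i) (toℕ j) (FinP.toℕ<n i))

hankel-odd-equiv : ∀ n →
  EquivTo (λ i j → qCat (suc (toℕ i ℕ.+ toℕ j))) (diagM (λ k → qPow (choose2 (suc (double (toℕ k))))))
hankel-odd-equiv n = ldl-equiv n _ _ _
  (pathsFrom0-unitriangular n (λ a → suc (double a)) (λ a<b → s≤s (double-mono-< a<b)))
  (λ i j → hankel-odd-entry n (toℕ i) (toℕ j) (FinP.toℕ<n i))

∸-solve : ∀ {x y z} → x ≡ z ℕ.+ y → x ∸ y ≡ z
∸-solve {y = y} {z} x≡z+y = trans (cong (_∸ y) x≡z+y) (NP.m+n∸n≡m z y)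

even-index : ∀ m a b → a ≤ m → b ≤ m →
  (2 ℕ.* m ℕ.+ 2) ∸ (suc a ℕ.+ suc b) ≡ (m ∸ a) ℕ.+ (m ∸ b)
even-index m a b a≤m b≤m = ∸-solve (begin
  2 ℕ.* m ℕ.+ 2
    ≡⟨ solve 1 (λ m → con 2 :* m :+ con 2 := m :+ m :+ con 2) refl m ⟩
  m ℕ.+ m ℕ.+ 2
    ≡⟨ cong₂ (λ s t → s ℕ.+ t ℕ.+ 2) (NP.m+[n∸m]≡n a≤m) (NP.m+[n∸m]≡n b≤m) ⟨
  (a ℕ.+ x) ℕ.+ (b ℕ.+ y) ℕ.+ 2
    ≡⟨ solve 4 (λ a x b y → (a :+ x) :+ (b :+ y) :+ con 2
                         := (x :+ y) :+ ((con 1 :+ a) :+ (con 1 :+ b))) refl a x b y ⟩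
  (x ℕ.+ y) ℕ.+ (suc a ℕ.+ suc b) ∎)
  where
  x y : ℕ
  x = m ∸ a
  y = m ∸ b
  open Eq.≡-Reasoning
  open +-*-Solver

odd-index : ∀ m a b → a < m → b < m →
  (2 ℕ.* m ℕ.+ 1) ∸ (suc a ℕ.+ suc b) ≡ suc ((m ∸ suc a) ℕ.+ (m ∸ suc b))
odd-index m a b a<m b<m = ∸-solve (begin
  2 ℕ.* m ℕ.+ 1
    ≡⟨ solve 1 (λ m → con 2 :* m :+ con 1 := m :+ m :+ con 1) refl m ⟩
  m ℕ.+ m ℕ.+ 1
    ≡⟨ cong₂ (λ s t → s ℕ.+ t ℕ.+ 1) (NP.m+[n∸m]≡n a<m) (NP.m+[n∸m]≡n b<m) ⟨
  (suc a ℕ.+ x) ℕ.+ (suc b ℕ.+ y) ℕ.+ 1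
    ≡⟨ solve 4 (λ a x b y → ((con 1 :+ a) :+ x) :+ ((con 1 :+ b) :+ y) :+ con 1
                         := (con 1 :+ (x :+ y)) :+ ((con 1 :+ a) :+ (con 1 :+ b))) refl a x b y ⟩
  suc (x ℕ.+ y) ℕ.+ (suc a ℕ.+ suc b) ∎)
  where
  x y : ℕ
  x = m ∸ suc a
  y = m ∸ suc b
  open Eq.≡-Reasoning
  open +-*-Solver

even-exponent : ∀ m a → double (m ∸ a) ≡ 2 ℕ.* m ∸ 2 ℕ.* a
even-exponent m a = trans (double-∸ m a) (cong₂ _∸_ (double≡2* m) (double≡2* a))

odd-exponent : ∀ m a → a < m → suc (double (m ∸ suc a)) ≡ (2 ℕ.* m ∸ 1) ∸ 2 ℕ.* a
odd-exponent m a a<m = begin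
  suc (double (m ∸ suc a))                ≡⟨ cong suc (double-∸ m (suc a)) ⟩
  suc (double m ∸ double (suc a))         ≡⟨ NP.+-∸-assoc 1 (double-mono-≤ a<m) ⟨
  double m ∸ suc (double a)               ≡⟨ NP.∸-+-assoc (double m) 1 (double a) ⟨
  (double m ∸ 1) ∸ double a               ≡⟨ cong₂ (λ s t → (s ∸ 1) ∸ t) (double≡2* m) (double≡2* a) ⟩
  (2 ℕ.* m ∸ 1) ∸ 2 ℕ.* a                 ∎
  where open Eq.≡-Reasoning

-- M_{2m-1} and its diagonal form are the index reversals of the odd Hankel
-- matrix and its diagonal form.
odd-part : ∀ m → EquivTo (Modd m) (Dodd m)
odd-part m = EquivTo-cong Modd≈ D≈ (EquivTo-reverse {A = H} {D = diagM d} (hankel-odd-equiv m))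
  where
  H : Mat m
  H i j = qCat (suc (toℕ i ℕ.+ toℕ j))
  d : Fin m → Poly
  d k = qPow (choose2 (suc (double (toℕ k))))
  opposite-toℕ : ∀ (i : Fin m) → toℕ (Fin.opposite i) ≡ m ∸ suc (toℕ i)
  opposite-toℕ = FinP.opposite-prop
  Modd≈ : Modd m ≈m reverse H
  Modd≈ i j = ≡⇒≈ (cong qCat (trans (odd-index m (toℕ i) (toℕ j) (FinP.toℕ<n i) (FinP.toℕ<n j))
    (sym (cong suc (cong₂ ℕ._+_ (opposite-toℕ i) (opposite-toℕ j))))))
  D≈ : reverse (diagM d) ≈m Dodd m
  D≈ i j = ≈-trans (reverse-diagM d i j) (diagM-cong (λ t → ≡⇒≈ (cong qPow (begin
    choose2 (suc (double (toℕ (Fin.opposite t))))  ≡⟨ cong (λ s → choose2 (suc (double s))) (opposite-toℕ t) ⟩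
    choose2 (suc (double (m ∸ suc (toℕ t))))     ≡⟨ cong choose2 (odd-exponent m (toℕ t) (FinP.toℕ<n t)) ⟩
    choose2 ((2 ℕ.* m ∸ 1) ∸ 2 ℕ.* toℕ t)        ≡⟨ choose2-C ((2 ℕ.* m ∸ 1) ∸ 2 ℕ.* toℕ t) ⟩
    ((2 ℕ.* m ∸ 1) ∸ 2 ℕ.* toℕ t) C 2            ∎))) i j)
    where open Eq.≡-Reasoning

-- likewise M_{2m} for the even Hankel matrix of size m+1
even-part : ∀ m → EquivTo (Meven m) (Deven m)
even-part m = EquivTo-cong Meven≈ D≈ (EquivTo-reverse {A = H} {D = diagM d} (hankel-even-equiv (suc m)))
  where
  H : Mat (suc m)
  H i j = qCat (toℕ i ℕ.+ toℕ j)
  d : Fin (suc m) → Poly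
  d k = qPow (choose2 (double (toℕ k)))
  opposite-toℕ : ∀ (i : Fin (suc m)) → toℕ (Fin.opposite i) ≡ m ∸ toℕ i
  opposite-toℕ = FinP.opposite-prop
  toℕ≤m : ∀ (i : Fin (suc m)) → toℕ i ≤ m
  toℕ≤m i = NP.≤-pred (FinP.toℕ<n i)
  Meven≈ : Meven m ≈m reverse H
  Meven≈ i j = ≡⇒≈ (cong qCat (trans (even-index m (toℕ i) (toℕ j) (toℕ≤m i) (toℕ≤m j))
    (sym (cong₂ ℕ._+_ (opposite-toℕ i) (opposite-toℕ j)))))
  D≈ : reverse (diagM d) ≈m Deven m
  D≈ i j = ≈-trans (reverse-diagM d i j) (diagM-cong (λ t → ≡⇒≈ (cong qPow (begin
    choose2 (double (toℕ (Fin.opposite t)))  ≡⟨ cong (λ s → choose2 (double s)) (opposite-toℕ t) ⟩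
    choose2 (double (m ∸ toℕ t))           ≡⟨ cong choose2 (even-exponent m (toℕ t)) ⟩
    choose2 (2 ℕ.* m ∸ 2 ℕ.* toℕ t)        ≡⟨ choose2-C (2 ℕ.* m ∸ 2 ℕ.* toℕ t) ⟩
    (2 ℕ.* m ∸ 2 ℕ.* toℕ t) C 2            ∎))) i j)
    where open Eq.≡-Reasoning

mainTheorem4 : (m : ℕ) → 1 ≤ m →
    EquivTo (Modd m) (Dodd m) × EquivTo (Meven m) (Deven m)
mainTheorem4 m _ = odd-part m , even-part m
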